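{- Let $C$ be a collage system with starting nonterminal $S$ generating a string $T$, whose rules are $\{X_i \rightarrow a_i : i=1,\dots,c'\}\cup\{Y_i\rightarrow A_iB_i : i=1,\dots,c''\}\cup\{Z_i\rightarrow R_i^{\ell_i},\ \ell_i>2 : i=1,\dots,c'''\}\cup\{W_i\rightarrow K_i[l_i..r_i] : i=1,\dots,c''''\}$. Then for every substring $T[i..j]$ of $T$ at least one of the following holds: (1) $i=j$ and $T[i]=a_k$ for some $1\le k\le c'$; (2) there is a rule $Y_k\rightarrow A_kB_k$ such that $T[i..j]$ equals a non-empty suffix of the expansion of $A_k$ followed by a non-empty prefix of the expansion of $B_k$; (3) there is a rule $Z_k\rightarrow R_k^{\ell_k}$ such that $T[i..j]$ equals a non-empty suffix of the expansion of $R_k$ followed by a non-empty prefix of the expansion of $R_k^{\ell_k-1}$.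
   Context: For a string $T$, $T[i..j]$ denotes the substring from position $i$ to $j$ (1-based). A collage system is a finite set of rules, each defining a distinct nonterminal, of four types: $X\rightarrow a$ ($a$ a terminal character); $X\rightarrow AB$ with $A,B$ nonterminals different from $X$; $X\rightarrow R^{\ell}$ with $R\neq X$ a nonterminal (expansion of $X$ is the expansion of $R$ repeated $\ell$ times); $X\rightarrow K[l..r]$ with $K\neq X$ a nonterminal (expansion of $X$ is the substring from position $l$ to $r$ of the expansion of $K$). The system is required to be acyclic: the derivation tree of any nonterminal $X$ contains neither $X$ nor any $X[l..r]$ as an internal node. The generated string is the expansion of a designated starting nonterminal $S$. -}

module Defs where

open import Data.Nat using (ℕ; zero; suc; _+_; _∸_; _≤_; _<_)
open import Data.Fin using (Fin)
open import Data.List using (List; []; _∷_; _++_; take; drop; length; concat; replicate)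
open import Data.Product using (Σ; ∃; _×_; _,_)
open import Relation.Binary.PropositionalEquality using (_≡_)
open import Relation.Nullary using (¬_)
open import Data.Unit using (⊤)

data Rule (A : Set) (n : ℕ) : Set where
  term  : A → Rule A n
  pair  : Fin n → Fin n → Rule A n
  power : Fin n → ℕ → Rule A n
  trunc : Fin n → ℕ → ℕ → Rule A n

-- A collage system: n nonterminals, one rule per nonterminal (so each rule
-- defines a distinct nonterminal), and a starting nonterminal.
record Collage (A : Set) : Set where
  field
    n     : ℕ
    rule  : Fin n → Rule A n
    start : Fin n

-- 1-based substring w[i..j]
sub : {A : Set} → List A → ℕ → ℕ → List A
sub w i j = take (suc j ∸ i) (drop (i ∸ 1) w)

data Expands {A : Set} (C : Collage A) : Fin (Collage.n C) → List A → Set where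
  e-term  : ∀ {X a} → Collage.rule C X ≡ term a → Expands C X (a ∷ [])
  e-pair  : ∀ {X Y Z u v} → Collage.rule C X ≡ pair Y Z →
            Expands C Y u → Expands C Z v → Expands C X (u ++ v)
  e-power : ∀ {X R ℓ u} → Collage.rule C X ≡ power R ℓ →
            Expands C R u → Expands C X (concat (replicate ℓ u))
  e-trunc : ∀ {X K l r u} → Collage.rule C X ≡ trunc K l r →
            Expands C K u → 1 ≤ l → l ≤ r → r ≤ length u →
            Expands C X (sub u l r)

WellFormedRule : {A : Set} {n : ℕ} → Fin n → Rule A n → Set
WellFormedRule X (term a)      = ⊤
WellFormedRule X (pair Y Z)    = ¬ Y ≡ X × ¬ Z ≡ X
WellFormedRule X (power R ℓ)   = ¬ R ≡ X × 2 < ℓ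
WellFormedRule X (trunc K l r) = ¬ K ≡ X

WellFormed : {A : Set} → Collage A → Set
WellFormed C = ∀ X → WellFormedRule X (Collage.rule C X)

Generates : {A : Set} → Collage A → List A → Set
Generates C T = Expands C (Collage.start C) T

NonEmptySuffix : {A : Set} → List A → List A → Set
NonEmptySuffix s u = ¬ s ≡ [] × ∃ λ w → u ≡ w ++ s

NonEmptyPrefix : {A : Set} → List A → List A → Set
NonEmptyPrefix p u = ¬ p ≡ [] × ∃ λ w → u ≡ p ++ w

-- By induction on a derivation, every non-empty factor of the expansion of a nonterminal is a
-- factor of the expansion of one of its children or crosses a boundary of its rule: it is the
-- terminal of X → a, crosses the cut between A and B in X → AB, or crosses the cut between some
-- copy of R and the next in X → R^ℓ, where the remaining copies form a prefix of R^(ℓ-1). A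
-- factor of K[l..r] is a factor of K, so truncation rules only pass factors on to their child.
module Submission where

open import Defs
open import Data.Nat using (ℕ; zero; suc; _≤_; _∸_; _+_; _⊓_)
open import Data.Nat.Properties using (m≤n⇒m⊓n≡m; ∸-monoˡ-≤; m∸n+n≡m; m>n⇒m∸n≢0; ≤-trans; n≤1+n)
open import Data.List using (List; []; _∷_; _++_; length; concat; replicate; take; drop)
open import Data.List.Properties
  using (∷-injective; ++-conicalˡ; ++-assoc; ++-identityʳ; length-take; length-drop; take++drop≡id)
open import Data.Product using (∃; ∃₂; _×_; _,_; proj₂)
open import Data.Sum using (_⊎_; inj₁; inj₂; map₂)
open import Data.Empty using (⊥-elim)
open import Relation.Nullary using (¬_)
open import Relation.Binary.PropositionalEquality using (_≡_; _≢_; refl; sym; trans; cong; subst)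
open Relation.Binary.PropositionalEquality.≡-Reasoning

private variable
  A : Set
  a : A
  m u v w : List A
  k : ℕ

++-≡-++ : (a b c d : List A) → a ++ b ≡ c ++ d →
          (∃ λ w → a ≡ c ++ w × d ≡ w ++ b) ⊎ (∃ λ w → c ≡ a ++ w × b ≡ w ++ d)
++-≡-++ []      b c       d eq = inj₂ (c , refl , eq)
++-≡-++ (x ∷ a) b []      d eq = inj₁ (x ∷ a , refl , sym eq)
++-≡-++ (x ∷ a) b (y ∷ c) d eq with ∷-injective eq
... | refl , eq′ with ++-≡-++ a b c d eq′
...   | inj₁ (w , a≡ , d≡) = inj₁ (w , cong (x ∷_) a≡ , d≡)
...   | inj₂ (w , c≡ , b≡) = inj₂ (w , cong (x ∷_) c≡ , b≡)

Factor : List A → List A → Set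
Factor m w = ∃₂ λ x y → w ≡ x ++ m ++ y

Straddles : List A → List A → List A → Set
Straddles m u v = ∃₂ λ s p → NonEmptySuffix s u × NonEmptyPrefix p v × m ≡ s ++ p

factor-trans : Factor m u → Factor u w → Factor m w
factor-trans {m = m} (x , y , u≡) (x′ , y′ , w≡) = x′ ++ x , y ++ y′ , (begin
  _                         ≡⟨ w≡ ⟩
  x′ ++ _ ++ y′             ≡⟨ cong (λ u → x′ ++ u ++ y′) u≡ ⟩
  x′ ++ (x ++ m ++ y) ++ y′ ≡⟨ cong (x′ ++_) (++-assoc x (m ++ y) y′) ⟩
  x′ ++ x ++ (m ++ y) ++ y′ ≡⟨ cong (λ z → x′ ++ x ++ z) (++-assoc m y y′) ⟩
  x′ ++ x ++ m ++ y ++ y′   ≡⟨ ++-assoc x′ x (m ++ y ++ y′) ⟨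
  (x′ ++ x) ++ m ++ y ++ y′ ∎)

sub-factor : (w : List A) (i j : ℕ) → Factor (sub w i j) w
sub-factor w i j = take (i ∸ 1) w , drop (suc j ∸ i) (drop (i ∸ 1) w) , (begin
  w                                ≡⟨ take++drop≡id (i ∸ 1) w ⟨
  take (i ∸ 1) w ++ drop (i ∸ 1) w ≡⟨ cong (take (i ∸ 1) w ++_) (take++drop≡id (suc j ∸ i) _) ⟨
  take (i ∸ 1) w ++ sub w i j ++ drop (suc j ∸ i) (drop (i ∸ 1) w) ∎)

¬factor-[] : m ≢ [] → ¬ Factor m []
¬factor-[] {m = m} m≢[] ([]    , y , eq) = m≢[] (++-conicalˡ m y (sym eq))
¬factor-[]          m≢[] (_ ∷ _ , _ , ())

factor-[-] : m ≢ [] → Factor m (a ∷ []) → m ≡ a ∷ []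
factor-[-] {m = []}     m≢[] _ = ⊥-elim (m≢[] refl)
factor-[-] {m = b ∷ m′} _    ([] , y , eq) with ∷-injective eq
... | refl , []≡ rewrite ++-conicalˡ m′ y (sym []≡) = refl
factor-[-]              m≢[] (_ ∷ x , y , eq) = ⊥-elim (¬factor-[] m≢[] (x , y , proj₂ (∷-injective eq)))

factor-++ : m ≢ [] → Factor m (u ++ v) → Factor m u ⊎ Factor m v ⊎ Straddles m u v
factor-++ {m = m} {u} {v} m≢[] (x , y , eq) with ++-≡-++ u v x (m ++ y) eq
... | inj₂ (w , _ , v≡) = inj₂ (inj₁ (w , y , v≡))
... | inj₁ (w , u≡ , my≡) with ++-≡-++ m y w v my≡
...   | inj₂ (w′ , w≡ , _) = inj₁ (x , w′ , trans u≡ (cong (x ++_) w≡))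
...   | inj₁ ([] , m≡ , _) = inj₁ (x , [] , trans u≡ (cong (x ++_) (begin
          w       ≡⟨ ++-identityʳ w ⟨
          w ++ [] ≡⟨ m≡ ⟨
          m       ≡⟨ ++-identityʳ m ⟨
          m ++ [] ∎)))
...   | inj₁ (p@(_ ∷ _) , m≡ , v≡) with w
...     | []          = inj₂ (inj₁ ([] , y , subst (λ p → v ≡ p ++ y) (sym m≡) v≡))
...     | s@(_ ∷ _)   = inj₂ (inj₂ (s , p , ((λ ()) , x , u≡) , ((λ ()) , y , v≡) , m≡))

straddles-++ʳ : Straddles m u v → Straddles m u (v ++ w)
straddles-++ʳ {w = w} (s , p , s-suffix , (p≢[] , v′ , v≡) , m≡) =
  s , p , s-suffix , (p≢[] , v′ ++ w , trans (cong (_++ w) v≡) (++-assoc p v′ w)) , m≡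

concat-replicate-suc : (k : ℕ) (u : List A) → concat (replicate (suc k) u) ≡ concat (replicate k u) ++ u
concat-replicate-suc zero    u = ++-identityʳ u
concat-replicate-suc (suc k) u = trans (cong (u ++_) (concat-replicate-suc k u)) (sym (++-assoc u _ u))

-- A factor crossing the cut after the i-th copy of u is followed by at most k - i further
-- copies, which form a prefix of u^k.
factor-concat-replicate : m ≢ [] → Factor m (concat (replicate (suc k) u)) →
                          Factor m u ⊎ Straddles m u (concat (replicate k u))
factor-concat-replicate {k = zero}  {u = u} _ f = inj₁ (subst (Factor _) (++-identityʳ u) f)
factor-concat-replicate {k = suc k} {u = u} m≢[] f with factor-++ m≢[] f
... | inj₁ in-u          = inj₁ in-u
... | inj₂ (inj₂ st)     = inj₂ st
... | inj₂ (inj₁ in-rest) =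
  map₂ (λ st → subst (Straddles _ u) (sym (concat-replicate-suc k u)) (straddles-++ʳ {w = u} st))
       (factor-concat-replicate {k = k} m≢[] in-rest)

length-sub : (w : List A) {i j : ℕ} → 1 ≤ i → j ≤ length w → length (sub w i j) ≡ suc j ∸ i
length-sub w {suc i} {j} _ j≤ = begin
  length (take (j ∸ i) (drop i w)) ≡⟨ length-take (j ∸ i) (drop i w) ⟩
  (j ∸ i) ⊓ length (drop i w)      ≡⟨ cong ((j ∸ i) ⊓_) (length-drop i w) ⟩
  (j ∸ i) ⊓ (length w ∸ i)         ≡⟨ m≤n⇒m⊓n≡m (∸-monoˡ-≤ i j≤) ⟩
  j ∸ i                            ∎

module _ {A : Set} (C : Collage A) where
  open Collage C

  Anchored : List A → Set
  Anchored m =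
    (∃ λ X → ∃ λ a → rule X ≡ term a × m ≡ a ∷ [])
    ⊎ (∃ λ Y → ∃ λ B₁ → ∃ λ B₂ → ∃ λ u → ∃ λ v → ∃ λ s → ∃ λ p →
        rule Y ≡ pair B₁ B₂ × Expands C B₁ u × Expands C B₂ v ×
        NonEmptySuffix s u × NonEmptyPrefix p v × m ≡ s ++ p)
    ⊎ (∃ λ Z → ∃ λ R → ∃ λ ℓ → ∃ λ u → ∃ λ s → ∃ λ p →
        rule Z ≡ power R ℓ × Expands C R u ×
        NonEmptySuffix s u × NonEmptyPrefix p (concat (replicate (ℓ ∸ 1) u)) ×
        m ≡ s ++ p)

  factor-anchored : ∀ {X w m} → Expands C X w → m ≢ [] → Factor m w → Anchored m
  factor-anchored (e-term {X} {a} r) m≢[] f = inj₁ (X , a , r , factor-[-] m≢[] f)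
  factor-anchored (e-pair {X} {Y} {Z} {u} {v} r du dv) m≢[] f with factor-++ m≢[] f
  ... | inj₁ in-u = factor-anchored du m≢[] in-u
  ... | inj₂ (inj₁ in-v) = factor-anchored dv m≢[] in-v
  ... | inj₂ (inj₂ (s , p , s-suffix , p-prefix , m≡)) =
    inj₂ (inj₁ (X , Y , Z , u , v , s , p , r , du , dv , s-suffix , p-prefix , m≡))
  factor-anchored (e-power {ℓ = zero} r du) m≢[] f = ⊥-elim (¬factor-[] m≢[] f)
  factor-anchored (e-power {X} {R} {suc k} {u} r du) m≢[] f with factor-concat-replicate {k = k} m≢[] f
  ... | inj₁ in-u = factor-anchored du m≢[] in-u
  ... | inj₂ (s , p , s-suffix , p-prefix , m≡) =
    inj₂ (inj₂ (X , R , suc k , u , s , p , r , du , s-suffix , p-prefix , m≡))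
  factor-anchored (e-trunc {l = l} {r} {u} _ du _ _ _) m≢[] f =
    factor-anchored du m≢[] (factor-trans f (sub-factor u l r))

lemma3p4 : {A : Set} (C : Collage A) → WellFormed C → (T : List A) → Generates C T →
    (i j : ℕ) → 1 ≤ i → i ≤ j → j ≤ length T →
    (i ≡ j × ∃ λ X → ∃ λ a → Collage.rule C X ≡ term a × sub T i j ≡ a ∷ [])
    ⊎ (∃ λ Y → ∃ λ B₁ → ∃ λ B₂ → ∃ λ u → ∃ λ v → ∃ λ s → ∃ λ p →
    Collage.rule C Y ≡ pair B₁ B₂ × Expands C B₁ u × Expands C B₂ v ×
    NonEmptySuffix s u × NonEmptyPrefix p v × sub T i j ≡ s ++ p)
    ⊎ (∃ λ Z → ∃ λ R → ∃ λ ℓ → ∃ λ u → ∃ λ s → ∃ λ p →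
    Collage.rule C Z ≡ power R ℓ × Expands C R u ×
    NonEmptySuffix s u × NonEmptyPrefix p (concat (replicate (ℓ ∸ 1) u)) ×
    sub T i j ≡ s ++ p)
lemma3p4 C _ T gen i@(suc i′) j 1≤i i≤j j≤ with factor-anchored C gen sub≢[] (sub-factor T i j)
  where
    sub≢[] : sub T i j ≢ []
    sub≢[] eq = m>n⇒m∸n≢0 i≤j (trans (sym (length-sub T 1≤i j≤)) (cong length eq))
... | inj₂ crossing = inj₂ crossing
... | inj₁ (X , a , r , sub≡) = inj₁ (i≡j , X , a , r , sub≡)
  where
    i≡j : i ≡ j
    i≡j = begin
      1 + i′       ≡⟨ cong (_+ i′) (trans (sym (length-sub T 1≤i j≤)) (cong length sub≡)) ⟨
      j ∸ i′ + i′  ≡⟨ m∸n+n≡m (≤-trans (n≤1+n i′) i≤j) ⟩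
      j            ∎
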